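{- Let $\lambda$ be a dominant weight of $\mathfrak{sl}_k\mathbb{C}$. The hyperplanes of the Kostant arrangements $\mathcal{A}^{(\psi)}_\lambda$, $\psi\in\mathfrak{S}_k$, are exactly the hyperplanes in $V$ defined by the equations $$\beta_{u_1}+\dots+\beta_{u_j}=\lambda_{v_1}+\dots+\lambda_{v_j}+\sum_{i=1}^j(\delta_{v_i}-\delta_{w_i}),$$ where $1\le j\le\lfloor k/2\rfloor$ and $U=\{u_1,\dots,u_j\}$, $V'=\{v_1,\dots,v_j\}$, $W=\{w_1,\dots,w_j\}$ range over all $j$-element subsets of $\{1,\dots,k\}$.
   Context: Identify $\mathfrak{h}^*$ with $V=\{x\in\mathbb{R}^k:\sum x_i=0\}$ (the variable $\beta=(\beta_1,\dots,\beta_k)$ ranges over $V$); fundamental weights $\omega_j=\frac1k(k-j,\dots,k-j,-j,\dots,-j)$ ($j$ entries $k-j$); $\delta=\frac12(k-1,k-3,\dots,-(k-1))$; $\mathfrak{S}_k$ acts by permuting coordinates ($\sigma(e_i)=e_{\sigma(i)}$); dominant means $\lambda$ in the weight lattice with $\lambda_1\ge\dots\ge\lambda_k$. For $\psi\in\mathfrak{S}_k$, the Kostant arrangement $\mathcal{A}^{(\psi)}_\lambda$ is the arrangement in $V$ of the hyperplanes $\langle\sigma(\lambda+\delta)-(\psi(\beta)+\delta),\theta(\omega_j)\rangle=0$ for $\sigma,\theta\in\mathfrak{S}_k$ and $1\le j\le k-1$, with $\langle\cdot,\cdot\rangle$ the standard dot product.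
   Formalization: The space $V$, in which β ranges and both families of hyperplanes are compared, consists of the vectors of ℚ^k with coordinate sum zero rather than of ℝ^k. -}

module Defs where

open import Data.Nat.Base as ℕ using (ℕ; zero; suc; NonZero; _<ᵇ_; _∸_)
open import Data.Integer.Base as ℤ using (ℤ; +_)
open import Data.Rational.Base using (ℚ; 0ℚ; _+_; _-_; _*_; -_; _/_)
import Data.Rational.Base
open import Data.Fin.Base using (Fin; toℕ)
import Data.Fin.Base
open import Data.Fin.Permutation using (Permutation′; _⟨$⟩ˡ_)
open import Data.Fin.Subset using (Subset)
open import Data.Vec.Base using (lookup)
open import Data.Bool.Base using (if_then_else_)
open import Data.Product.Base using (Σ; _×_)
open import Relation.Binary.PropositionalEquality using (_≡_)
open import Function.Bundles using (_⇔_)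

Vect : ℕ → Set
Vect k = Fin k → ℚ

sumF : ∀ {k} → Vect k → ℚ
sumF {zero} x = 0ℚ
sumF {suc k} x = x Fin.zero + sumF (λ i → x (Fin.suc i))

sumOver : ∀ {k} → Subset k → Vect k → ℚ
sumOver U f = sumF (λ i → if lookup U i then f i else 0ℚ)

_⊕_ : ∀ {k} → Vect k → Vect k → Vect k
(x ⊕ y) i = x i + y i

_⊖_ : ∀ {k} → Vect k → Vect k → Vect k
(x ⊖ y) i = x i - y i

⟪_,_⟫ : ∀ {k} → Vect k → Vect k → ℚ
⟪ x , y ⟫ = sumF (λ i → x i * y i)

InV : ∀ {k} → Vect k → Set
InV x = sumF x ≡ 0ℚ

-- action of 𝔖_k by permuting coordinates: σ(e_i) = e_{σ(i)},
-- so (σ x)_m = x_{σ⁻¹(m)}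
act : ∀ {k} → Permutation′ k → Vect k → Vect k
act σ x m = x (σ ⟨$⟩ˡ m)

-- δ = ½(k-1, k-3, …, -(k-1)); 0-indexed: δ_i = (k-1-2i)/2
δ : (k : ℕ) → Vect k
δ k i = ((+ k) ℤ.- (+ 1) ℤ.- (+ (2 ℕ.* toℕ i))) / 2

ω : (k : ℕ) → .{{_ : NonZero k}} → ℕ → Vect k
ω k j i = if toℕ i <ᵇ j then (+ (k ∸ j)) / k else ℤ.- (+ j) / k

IsInt : ℚ → Set
IsInt q = Σ ℤ (λ z → q ≡ z / 1)

-- λ lies in the weight lattice of sl_k (identified with a lattice in V):
-- λ ∈ V and all λ_i - λ_j ∈ ℤ (i.e. ⟨λ, α^∨⟩ ∈ ℤ for all coroots)
IsWeight : ∀ {k} → Vect k → Set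
IsWeight {k} lam = InV lam × ((i j : Fin k) → IsInt (lam i - lam j))

IsDominant : ∀ {k} → Vect k → Set
IsDominant {k} lam =
  IsWeight lam × ((i j : Fin k) → i Data.Fin.Base.≤ j → lam j Data.Rational.Base.≤ lam i)

-- the hyperplane of A^{(ψ)}_λ indexed by σ, θ, j, as a predicate on β :
-- ⟨σ(λ+δ) - (ψ(β)+δ), θ(ω_j)⟩ = 0
KostantHyp : (k : ℕ) → .{{_ : NonZero k}} → Vect k →
             (ψ σ θ : Permutation′ k) → ℕ → Vect k → Set
KostantHyp k lam ψ σ θ j β =
  ⟪ act σ (lam ⊕ δ k) ⊖ (act ψ β ⊕ δ k) , act θ (ω k j) ⟫ ≡ 0ℚ

EqHyp : (k : ℕ) → Vect k → (U V' W : Subset k) → Vect k → Set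
EqHyp k lam U V' W β =
  sumOver U β ≡ sumOver V' lam + (sumOver V' (δ k) - sumOver W (δ k))

SameInV : ∀ {k} → (Vect k → Set) → (Vect k → Set) → Set
SameInV {k} P Q = (β : Vect k) → InV β → P β ⇔ Q β

module Submission where

-- Write W = θ{1,…,j}.  The vector θ(ω_j) takes the value (k−j)/k on W and −j/k off W,
-- and these two values differ.  The vector X = σ(λ+δ) − (ψ(β)+δ) has coordinate sum 0
-- whenever λ, β ∈ V, so ⟨X, θ(ω_j)⟩ is a nonzero multiple of Σ_{m∈W} X_m, which equals
-- Σ_{σ⁻¹W}(λ+δ) − Σ_{ψ⁻¹W} β − Σ_W δ.  Hence the Kostant hyperplane is the displayed one
-- with U = ψ⁻¹W, V′ = σ⁻¹W.  Replacing U, V′, W by their complements negates both sides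
-- of the equation on V, which brings j down to at most ⌊k/2⌋.  Conversely, any three
-- j-subsets arise this way: choose θ carrying {1,…,j} onto W, and σ, ψ carrying V′, U onto W.

open import Defs
open import Data.Nat.Base using (ℕ; NonZero; _≤_; _<_; ⌊_/2⌋)
open import Data.Fin.Base using (Fin)
open import Data.Fin.Permutation using (Permutation′)
open import Data.Fin.Subset using (Subset; ∣_∣)
open import Data.Product.Base using (Σ; _×_)
open import Relation.Binary.PropositionalEquality using (_≡_)

import Algebra.Properties.CommutativeMonoid.Sum as CommutativeMonoidSum
open import Data.Bool.Base using (Bool; true; false; if_then_else_; not)
open import Data.Fin.Base using (zero; suc; toℕ; fromℕ<)
open import Data.Fin.Patterns using (0F)
open import Data.Fin.Permutation
  using (_⟨$⟩ʳ_; _⟨$⟩ˡ_; flip; inverseˡ; inverseʳ; lift₀; transpose; _∘ₚ_)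
  renaming (id to idₚ)
open import Data.Fin.Properties using (toℕ-fromℕ<; toℕ-injective) renaming (_≟_ to _≟ᶠ_)
open import Data.Fin.Subset using (inside; outside; ∁)
open import Data.Fin.Subset.Properties using (∣p∣≤n; ∣∁p∣≡n∸∣p∣)
import Data.Integer.Base as ℤ
open import Data.Nat.Base as ℕ using (zero; suc; _∸_; _<ᵇ_; ⌈_/2⌉)
open import Data.Nat.Properties as ℕ
  using (_≤?_; m≤n+o⇒m∸n≤o; m<n⇒0<n∸m; ⌊n/2⌋+⌈n/2⌉≡n; ⌊n/2⌋-mono; ⌊n/2⌋<n; n≤1+n)
open import Data.Product.Base using (_,_)
open import Data.Rational.Base
  using (ℚ; 0ℚ; 1ℚ; _+_; _-_; _*_; -_; _/_; 1/_; normalize; ≢-nonZero)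
open import Data.Rational.Properties
  using (+-0-group; +-0-commutativeMonoid; +-*-commutativeRing; _≟_; nonNeg≢neg;
         normalize-nonNeg; normalize-pos; neg-pos; neg-injective; +-identityˡ;
         *-identityˡ; *-inverseˡ; *-assoc; *-zeroʳ)
open import Algebra.Properties.Group +-0-group using (x∙y⁻¹≈ε⇒x≈y; x≈y⇒x∙y⁻¹≈ε)
open import Data.Vec.Base using (_∷_; []; lookup; tabulate)
open import Data.Vec.Properties using (lookup∘tabulate; lookup-map)
open import Function.Base using (_∘_)
open import Function.Bundles using (_⇔_; mk⇔; Equivalence)
open import Function.Properties.Equivalence using () renaming (trans to ⇔-trans)
open import Relation.Binary.PropositionalEquality
  using (_≢_; _≗_; refl; sym; trans; cong; cong₂; subst; subst₂; module ≡-Reasoning)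
open import Relation.Nullary using (yes; no; contradiction)
open import Relation.Nullary.Decidable using (dec⇒maybe)
open import Tactic.RingSolver using (solve-∀)
open import Tactic.RingSolver.Core.AlmostCommutativeRing
  using (AlmostCommutativeRing; fromCommutativeRing)

open ≡-Reasoning

ℚ-ring : AlmostCommutativeRing _ _
ℚ-ring = fromCommutativeRing +-*-commutativeRing (λ x → dec⇒maybe (0ℚ ≟ x))

p-q≡0⇔p≡q : ∀ {p q} → p - q ≡ 0ℚ ⇔ p ≡ q
p-q≡0⇔p≡q = mk⇔ (x∙y⁻¹≈ε⇒x≈y _ _) x≈y⇒x∙y⁻¹≈ε

p≢0∧p*q≡0⇒q≡0 : ∀ {p q} → p ≢ 0ℚ → p * q ≡ 0ℚ → q ≡ 0ℚ
p≢0∧p*q≡0⇒q≡0 {p} {q} p≢0 pq≡0 = begin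
  q                ≡⟨ *-identityˡ q ⟨
  1ℚ * q           ≡⟨ cong (_* q) (*-inverseˡ p) ⟨
  (1/ p * p) * q   ≡⟨ *-assoc (1/ p) p q ⟩
  1/ p * (p * q)   ≡⟨ cong (1/ p *_) pq≡0 ⟩
  1/ p * 0ℚ        ≡⟨ *-zeroʳ (1/ p) ⟩
  0ℚ               ∎
  where
  instance _ = ≢-nonZero p≢0

module ℚΣ = CommutativeMonoidSum +-0-commutativeMonoid
module ℕΣ = CommutativeMonoidSum ℕ.+-0-commutativeMonoid

sumF≡sum : ∀ {k} (f : Vect k) → sumF f ≡ ℚΣ.sum f
sumF≡sum {zero}  f = refl
sumF≡sum {suc k} f = cong (f zero +_) (sumF≡sum (f ∘ suc))

sumF-cong : ∀ {k} {f g : Vect k} → f ≗ g → sumF f ≡ sumF g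
sumF-cong {f = f} {g} f≗g = begin
  sumF f     ≡⟨ sumF≡sum f ⟩
  ℚΣ.sum f   ≡⟨ ℚΣ.sum-cong-≗ f≗g ⟩
  ℚΣ.sum g   ≡⟨ sumF≡sum g ⟨
  sumF g     ∎

sumF-act : ∀ {k} (π : Permutation′ k) (f : Vect k) → sumF (act π f) ≡ sumF f
sumF-act π f = begin
  sumF (act π f)     ≡⟨ sumF≡sum (act π f) ⟩
  ℚΣ.sum (act π f)   ≡⟨ ℚΣ.sum-permute f (flip π) ⟨
  ℚΣ.sum f           ≡⟨ sumF≡sum f ⟨
  sumF f             ∎

sumF-⊕ : ∀ {k} (f g : Vect k) → sumF (f ⊕ g) ≡ sumF f + sumF g
sumF-⊕ {zero}  f g = refl
sumF-⊕ {suc k} f g =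
  trans (cong (f zero + g zero +_) (sumF-⊕ (f ∘ suc) (g ∘ suc))) (interchange (f zero) (g zero) _ _)
  where
  interchange : ∀ a b c d → (a + b) + (c + d) ≡ (a + c) + (b + d)
  interchange = solve-∀ ℚ-ring

sumF-⊖ : ∀ {k} (f g : Vect k) → sumF (f ⊖ g) ≡ sumF f - sumF g
sumF-⊖ {zero}  f g = refl
sumF-⊖ {suc k} f g =
  trans (cong (f zero - g zero +_) (sumF-⊖ (f ∘ suc) (g ∘ suc))) (interchange (f zero) (g zero) _ _)
  where
  interchange : ∀ a b c d → (a - b) + (c - d) ≡ (a + c) - (b + d)
  interchange = solve-∀ ℚ-ring

mask : ∀ {k} → Subset k → Vect k → Vect k
mask S f i = if lookup S i then f i else 0ℚ

sumOver-⊕ : ∀ {k} (S : Subset k) (f g : Vect k) →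
            sumOver S (f ⊕ g) ≡ sumOver S f + sumOver S g
sumOver-⊕ S f g = trans (sumF-cong pointwise) (sumF-⊕ (mask S f) (mask S g))
  where
  pointwise : mask S (f ⊕ g) ≗ mask S f ⊕ mask S g
  pointwise i with lookup S i
  ... | true  = refl
  ... | false = refl

sumOver-⊖ : ∀ {k} (S : Subset k) (f g : Vect k) →
            sumOver S (f ⊖ g) ≡ sumOver S f - sumOver S g
sumOver-⊖ S f g = trans (sumF-cong pointwise) (sumF-⊖ (mask S f) (mask S g))
  where
  pointwise : mask S (f ⊖ g) ≗ mask S f ⊖ mask S g
  pointwise i with lookup S i
  ... | true  = refl
  ... | false = refl

sumOver-∁ : ∀ {k} (S : Subset k) (f : Vect k) → sumOver (∁ S) f ≡ sumF f - sumOver S f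
sumOver-∁ S f = trans (sumF-cong pointwise) (sumF-⊖ f (mask S f))
  where
  x≡x-0 : ∀ x → x ≡ x - 0ℚ
  x≡x-0 = solve-∀ ℚ-ring
  0≡x-x : ∀ x → 0ℚ ≡ x - x
  0≡x-x = solve-∀ ℚ-ring
  pointwise : mask (∁ S) f ≗ f ⊖ mask S f
  pointwise i rewrite lookup-map i not S with lookup S i
  ... | true  = 0≡x-x (f i)
  ... | false = x≡x-0 (f i)

indicator : Bool → ℕ
indicator b = if b then 1 else 0

∣∣≡sum : ∀ {k} (S : Subset k) → ∣ S ∣ ≡ ℕΣ.sum (indicator ∘ lookup S)
∣∣≡sum []            = refl
∣∣≡sum (inside ∷ S)  = cong suc (∣∣≡sum S)
∣∣≡sum (outside ∷ S) = ∣∣≡sum S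

record IsPreimage {k} (π : Permutation′ k) (S T : Subset k) : Set where
  constructor isPreimage
  field lookup-preimage : ∀ i → lookup T i ≡ lookup S (π ⟨$⟩ʳ i)

preimage : ∀ {k} → Permutation′ k → Subset k → Subset k
preimage π S = tabulate (lookup S ∘ (π ⟨$⟩ʳ_))

preimage-isPreimage : ∀ {k} (π : Permutation′ k) (S : Subset k) →
                      IsPreimage π S (preimage π S)
preimage-isPreimage π S = isPreimage (lookup∘tabulate (lookup S ∘ (π ⟨$⟩ʳ_)))

isPreimage-flip : ∀ {k} {π : Permutation′ k} {S T} → IsPreimage π S T → IsPreimage (flip π) T S
isPreimage-flip {π = π} {S} (isPreimage T≐) = isPreimage λ i →
  trans (cong (lookup S) (sym (inverseʳ π))) (sym (T≐ (π ⟨$⟩ˡ i)))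

isPreimage-∘ : ∀ {k} {π ρ : Permutation′ k} {S T R} →
               IsPreimage π S T → IsPreimage ρ T R → IsPreimage (ρ ∘ₚ π) S R
isPreimage-∘ {ρ = ρ} (isPreimage T≐) (isPreimage R≐) = isPreimage λ i → trans (R≐ i) (T≐ (ρ ⟨$⟩ʳ i))

isPreimage-∣∣ : ∀ {k} {π : Permutation′ k} {S T} → IsPreimage π S T → ∣ T ∣ ≡ ∣ S ∣
isPreimage-∣∣ {π = π} {S} {T} (isPreimage T≐) = begin
  ∣ T ∣                          ≡⟨ ∣∣≡sum T ⟩
  ℕΣ.sum (indicator ∘ lookup T)  ≡⟨ ℕΣ.sum-cong-≗ (cong indicator ∘ T≐) ⟩
  ℕΣ.sum (indicator ∘ lookup S ∘ (π ⟨$⟩ʳ_))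
                                 ≡⟨ ℕΣ.sum-permute (indicator ∘ lookup S) π ⟨
  ℕΣ.sum (indicator ∘ lookup S)  ≡⟨ ∣∣≡sum S ⟨
  ∣ S ∣                          ∎

sumOver-act : ∀ {k} {π : Permutation′ k} {S T} → IsPreimage π S T →
              (f : Vect k) → sumOver S (act π f) ≡ sumOver T f
sumOver-act {π = π} {S} {T} (isPreimage T≐) f = begin
  sumF (mask S (act π f))                 ≡⟨ sumF-act (flip π) _ ⟨
  sumF (act (flip π) (mask S (act π f)))  ≡⟨ sumF-cong pointwise ⟩
  sumF (mask T f)                         ∎
  where
  pointwise : act (flip π) (mask S (act π f)) ≗ mask T f
  pointwise i rewrite T≐ i | inverseˡ π {i} = refl

initial : ∀ {k} → ℕ → Subset k
initial j = tabulate (λ i → toℕ i <ᵇ j)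

∣initial∣ : ∀ {k j} → j ≤ k → ∣ initial {k} j ∣ ≡ j
∣initial∣ {zero}  ℕ.z≤n       = refl
∣initial∣ {suc k} ℕ.z≤n       = ∣initial∣ {k} ℕ.z≤n
∣initial∣ {suc k} (ℕ.s≤s j≤k) = cong suc (∣initial∣ j≤k)

initial-last : ∀ {k m} (i : Fin k) → toℕ i ≡ m → lookup (initial (suc m)) i ≡ true
initial-last zero    refl = refl
initial-last (suc i) refl = initial-last i refl

initial-bound : ∀ {k m} (i : Fin k) → toℕ i ≡ m → lookup (initial m) i ≡ false
initial-bound zero    refl = refl
initial-bound (suc i) refl = initial-bound i refl

initial-suc : ∀ {k} m (i : Fin k) → toℕ i ≢ m → lookup (initial (suc m)) i ≡ lookup (initial m) i
initial-suc zero    zero    i≢m = contradiction refl i≢m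
initial-suc (suc m) zero    i≢m = refl
initial-suc zero    (suc i) i≢m = refl
initial-suc (suc m) (suc i) i≢m = initial-suc m i (i≢m ∘ cong suc)

-- If 0 ∉ S and ∣S∣ = m+1, the transposition 0 ↔ m+1 moves the gap at 0 just behind
-- the block {0,…,m}.
sorting : ∀ {k} (S : Subset k) n → ∣ S ∣ ≡ n → Σ (Permutation′ k) λ π → IsPreimage π S (initial n)
sorting []            n       _ = idₚ , isPreimage λ ()
sorting (inside ∷ S)  (suc n) ∣S∣≡n with sorting S n (ℕ.suc-injective ∣S∣≡n)
... | π , isPreimage S≐ = lift₀ π , isPreimage λ { zero → refl ; (suc i) → S≐ i }
sorting (outside ∷ S) zero    ∣S∣≡0 with sorting S zero ∣S∣≡0
... | π , isPreimage S≐ = lift₀ π , isPreimage λ { zero → refl ; (suc i) → S≐ i }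
sorting {suc k} (outside ∷ S) (suc m) ∣S∣≡1+m with sorting S (suc m) ∣S∣≡1+m
... | π , isPreimage S≐ = transpose 0F (suc a) ∘ₚ lift₀ π , isPreimage moved
  where
  m<k : m < k
  m<k = subst (_≤ k) ∣S∣≡1+m (∣p∣≤n S)
  a : Fin k
  a = fromℕ< m<k
  a≡m : toℕ a ≡ m
  a≡m = toℕ-fromℕ< m<k
  moved : ∀ i → lookup (initial (suc m)) i
                ≡ lookup (outside ∷ S) ((transpose 0F (suc a) ∘ₚ lift₀ π) ⟨$⟩ʳ i)
  moved zero = trans (sym (initial-last a a≡m)) (S≐ a)
  moved (suc i) with i ≟ᶠ a
  ... | yes refl = initial-bound a a≡m
  ... | no i≢a   = trans (sym (initial-suc m i i≢m)) (S≐ i)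
    where
    i≢m : toℕ i ≢ m
    i≢m i≡m = i≢a (toℕ-injective (trans i≡m (sym a≡m)))

twoValued : ∀ {k} → Subset k → ℚ → ℚ → Vect k
twoValued S c d i = if lookup S i then c else d

⟪⟫-twoValued : ∀ {k} (x : Vect k) (S : Subset k) c d →
               ⟪ x , twoValued S c d ⟫ ≡ d * sumF x + (c - d) * sumOver S x
⟪⟫-twoValued x [] c d = base c d
  where
  base : ∀ c d → 0ℚ ≡ d * 0ℚ + (c - d) * 0ℚ
  base = solve-∀ ℚ-ring
⟪⟫-twoValued x (inside ∷ S) c d =
  trans (cong (x 0F * c +_) (⟪⟫-twoValued (x ∘ suc) S c d)) (step (x 0F) c d _ _)
  where
  step : ∀ x₀ c d Σx ΣSx → x₀ * c + (d * Σx + (c - d) * ΣSx) ≡ d * (x₀ + Σx) + (c - d) * (x₀ + ΣSx)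
  step = solve-∀ ℚ-ring
⟪⟫-twoValued x (outside ∷ S) c d =
  trans (cong (x 0F * d +_) (⟪⟫-twoValued (x ∘ suc) S c d)) (step (x 0F) c d _ _)
  where
  step : ∀ x₀ c d Σx ΣSx → x₀ * d + (d * Σx + (c - d) * ΣSx) ≡ d * (x₀ + Σx) + (c - d) * (0ℚ + ΣSx)
  step = solve-∀ ℚ-ring

module _ (k : ℕ) .{{_ : NonZero k}} where

  ω⁺ ω⁻ : ℕ → ℚ
  ω⁺ j = ℤ.+ (k ∸ j) / k
  ω⁻ j = ℤ.- (ℤ.+ j) / k

  ω≗twoValued : ∀ j → ω k j ≗ twoValued (initial j) (ω⁺ j) (ω⁻ j)
  ω≗twoValued j i rewrite lookup∘tabulate (λ i → toℕ i <ᵇ j) i = refl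

  -- ω⁺ j is nonnegative while ω⁻ j is negative.
  ω⁺≢ω⁻ : ∀ {j} → 1 ≤ j → ω⁺ j ≢ ω⁻ j
  ω⁺≢ω⁻ {suc j} _ = nonNeg≢neg _ _
    {{normalize-nonNeg (k ∸ suc j) k}} {{neg-pos {normalize (suc j) k} (normalize-pos (suc j) k)}}

  act-ω : ∀ {θ : Permutation′ k} {j W} → IsPreimage (flip θ) (initial j) W →
          act θ (ω k j) ≗ twoValued W (ω⁺ j) (ω⁻ j)
  act-ω {θ} {j} (isPreimage W≐) m rewrite W≐ m = ω≗twoValued j (θ ⟨$⟩ˡ m)

kostantHyp⇔eqHyp : ∀ k .{{_ : NonZero k}} {lam : Vect k} → InV lam →
  ∀ {ψ σ θ : Permutation′ k} {j U V W} → 1 ≤ j →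
  IsPreimage (flip θ) (initial j) W → IsPreimage σ W V → IsPreimage ψ W U →
  SameInV (KostantHyp k lam ψ σ θ j) (EqHyp k lam U V W)
kostantHyp⇔eqHyp k {lam} Σλ≡0 {ψ} {σ} {θ} {j} {U} {V} {W} 1≤j W≐ V≐ U≐ β Σβ≡0 =
  mk⇔ (λ onKostant → sym (Equivalence.to p-q≡0⇔p≡q
                            (p≢0∧p*q≡0⇒q≡0 gap≢0 (trans (sym ⟪X,θω⟫) onKostant))))
      (λ onEq → trans ⟪X,θω⟫ (trans (cong (gap *_) (Equivalence.from p-q≡0⇔p≡q (sym onEq)))
                                    (*-zeroʳ gap)))
  where
  L X : Vect k
  L = lam ⊕ δ k
  X = act σ L ⊖ (act ψ β ⊕ δ k)
  gap rhs : ℚ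
  gap = ω⁺ k j - ω⁻ k j
  rhs = sumOver V lam + (sumOver V (δ k) - sumOver W (δ k))

  gap≢0 : gap ≢ 0ℚ
  gap≢0 = ω⁺≢ω⁻ k 1≤j ∘ Equivalence.to p-q≡0⇔p≡q

  ΣX≡0 : sumF X ≡ 0ℚ
  ΣX≡0 = trans (sumF-⊖ (act σ L) (act ψ β ⊕ δ k)) (Equivalence.from p-q≡0⇔p≡q (begin
    sumF (act σ L)                 ≡⟨ sumF-act σ L ⟩
    sumF L                         ≡⟨ sumF-⊕ lam (δ k) ⟩
    sumF lam + sumF (δ k)          ≡⟨ cong (_+ sumF (δ k)) (trans Σλ≡0 (sym Σβ≡0)) ⟩
    sumF β + sumF (δ k)            ≡⟨ cong (_+ sumF (δ k)) (sumF-act ψ β) ⟨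
    sumF (act ψ β) + sumF (δ k)    ≡⟨ sumF-⊕ (act ψ β) (δ k) ⟨
    sumF (act ψ β ⊕ δ k)           ∎))

  ΣWX : sumOver W X ≡ rhs - sumOver U β
  ΣWX = begin
    sumOver W X
      ≡⟨ sumOver-⊖ W (act σ L) (act ψ β ⊕ δ k) ⟩
    sumOver W (act σ L) - sumOver W (act ψ β ⊕ δ k)
      ≡⟨ cong₂ _-_ (sumOver-act V≐ L) (sumOver-⊕ W (act ψ β) (δ k)) ⟩
    sumOver V L - (sumOver W (act ψ β) + sumOver W (δ k))
      ≡⟨ cong₂ (λ s t → s - (t + sumOver W (δ k))) (sumOver-⊕ V lam (δ k)) (sumOver-act U≐ β) ⟩
    (sumOver V lam + sumOver V (δ k)) - (sumOver U β + sumOver W (δ k))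
      ≡⟨ regroup (sumOver U β) (sumOver V lam) (sumOver V (δ k)) (sumOver W (δ k)) ⟩
    rhs - sumOver U β
      ∎
    where
    regroup : ∀ a b c d → (b + c) - (a + d) ≡ (b + (c - d)) - a
    regroup = solve-∀ ℚ-ring

  ⟪X,θω⟫ : ⟪ X , act θ (ω k j) ⟫ ≡ gap * (rhs - sumOver U β)
  ⟪X,θω⟫ = begin
    ⟪ X , act θ (ω k j) ⟫
      ≡⟨ sumF-cong (cong (X _ *_) ∘ act-ω k {θ} {j} W≐) ⟩
    ⟪ X , twoValued W (ω⁺ k j) (ω⁻ k j) ⟫
      ≡⟨ ⟪⟫-twoValued X W _ _ ⟩
    ω⁻ k j * sumF X + gap * sumOver W X
      ≡⟨ cong₂ (λ s t → ω⁻ k j * s + gap * t) ΣX≡0 ΣWX ⟩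
    ω⁻ k j * 0ℚ + gap * (rhs - sumOver U β)
      ≡⟨ cong (_+ gap * (rhs - sumOver U β)) (*-zeroʳ (ω⁻ k j)) ⟩
    0ℚ + gap * (rhs - sumOver U β)
      ≡⟨ +-identityˡ _ ⟩
    gap * (rhs - sumOver U β)
      ∎

eqHyp⇔eqHyp-∁ : ∀ k {lam : Vect k} → InV lam → (U V W : Subset k) →
                SameInV (EqHyp k lam U V W) (EqHyp k lam (∁ U) (∁ V) (∁ W))
eqHyp⇔eqHyp-∁ k {lam} Σλ≡0 U V W β Σβ≡0 =
  mk⇔ (λ onEq → trans lhs∁ (trans (cong -_ onEq) (sym rhs∁)))
      (λ onEq∁ → neg-injective (trans (sym lhs∁) (trans onEq∁ rhs∁)))
  where
  B C D : ℚ
  B = sumOver V lam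
  C = sumOver V (δ k)
  D = sumOver W (δ k)

  lhs∁ : sumOver (∁ U) β ≡ - sumOver U β
  lhs∁ = begin
    sumOver (∁ U) β          ≡⟨ sumOver-∁ U β ⟩
    sumF β - sumOver U β     ≡⟨ cong (_- sumOver U β) Σβ≡0 ⟩
    0ℚ - sumOver U β         ≡⟨ +-identityˡ _ ⟩
    - sumOver U β            ∎

  rhs∁ : sumOver (∁ V) lam + (sumOver (∁ V) (δ k) - sumOver (∁ W) (δ k)) ≡ - (B + (C - D))
  rhs∁ = begin
    sumOver (∁ V) lam + (sumOver (∁ V) (δ k) - sumOver (∁ W) (δ k))
      ≡⟨ cong₂ (λ s t → s + (t - sumOver (∁ W) (δ k))) (sumOver-∁ V lam) (sumOver-∁ V (δ k)) ⟩
    (sumF lam - B) + ((sumF (δ k) - C) - sumOver (∁ W) (δ k))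
      ≡⟨ cong₂ (λ s t → (s - B) + ((sumF (δ k) - C) - t)) Σλ≡0 (sumOver-∁ W (δ k)) ⟩
    (0ℚ - B) + ((sumF (δ k) - C) - (sumF (δ k) - D))
      ≡⟨ negate B C D (sumF (δ k)) ⟩
    - (B + (C - D))
      ∎
    where
    negate : ∀ B C D Δ → (0ℚ - B) + ((Δ - C) - (Δ - D)) ≡ - (B + (C - D))
    negate = solve-∀ ℚ-ring

kostantHyp-isEqHyp : ∀ k .{{_ : NonZero k}} {lam : Vect k} → InV lam →
  (ψ σ θ : Permutation′ k) (j : ℕ) → 1 ≤ j → j ≤ k →
  Σ (Subset k) λ U → Σ (Subset k) λ V → Σ (Subset k) λ W →
    (∣ U ∣ ≡ j × ∣ V ∣ ≡ j × ∣ W ∣ ≡ j) × SameInV (KostantHyp k lam ψ σ θ j) (EqHyp k lam U V W)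
kostantHyp-isEqHyp k Σλ≡0 ψ σ θ j 1≤j j≤k =
  U , V , W , (trans (isPreimage-∣∣ U≐) ∣W∣≡j , trans (isPreimage-∣∣ V≐) ∣W∣≡j , ∣W∣≡j) ,
  kostantHyp⇔eqHyp k Σλ≡0 1≤j W≐ V≐ U≐
  where
  W V U : Subset k
  W = preimage (flip θ) (initial j)
  V = preimage σ W
  U = preimage ψ W
  W≐ : IsPreimage (flip θ) (initial j) W
  W≐ = preimage-isPreimage (flip θ) (initial j)
  V≐ : IsPreimage σ W V
  V≐ = preimage-isPreimage σ W
  U≐ : IsPreimage ψ W U
  U≐ = preimage-isPreimage ψ W
  ∣W∣≡j : ∣ W ∣ ≡ j
  ∣W∣≡j = trans (isPreimage-∣∣ W≐) (∣initial∣ j≤k)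

eqHyp-isKostantHyp : ∀ k .{{_ : NonZero k}} {lam : Vect k} → InV lam →
  ∀ {j} (U V W : Subset k) → 1 ≤ j → ∣ U ∣ ≡ j → ∣ V ∣ ≡ j → ∣ W ∣ ≡ j →
  Σ (Permutation′ k) λ ψ → Σ (Permutation′ k) λ σ → Σ (Permutation′ k) λ θ →
    SameInV (KostantHyp k lam ψ σ θ j) (EqHyp k lam U V W)
eqHyp-isKostantHyp k Σλ≡0 {j} U V W 1≤j ∣U∣≡j ∣V∣≡j ∣W∣≡j
  with sorting U j ∣U∣≡j | sorting V j ∣V∣≡j | sorting W j ∣W∣≡j
... | πU , initial≐U | πV , initial≐V | θ , initial≐W =
  flip πU ∘ₚ θ , flip πV ∘ₚ θ , θ ,
  kostantHyp⇔eqHyp k Σλ≡0 1≤j (isPreimage-flip initial≐W)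
    (isPreimage-∘ initial≐W (isPreimage-flip initial≐V))
    (isPreimage-∘ initial≐W (isPreimage-flip initial≐U))

⌊n/2⌋<m⇒n∸m≤⌊n/2⌋ : ∀ n {m} → ⌊ n /2⌋ < m → n ∸ m ≤ ⌊ n /2⌋
⌊n/2⌋<m⇒n∸m≤⌊n/2⌋ n {m} ⌊n/2⌋<m = m≤n+o⇒m∸n≤o n m
  (subst₂ _≤_ (⌊n/2⌋+⌈n/2⌉≡n n) (ℕ.+-comm ⌊ n /2⌋ m) (ℕ.+-monoʳ-≤ ⌊ n /2⌋ ⌈n/2⌉≤m))
  where
  ⌈n/2⌉≤m : ⌈ n /2⌉ ≤ m
  ⌈n/2⌉≤m = ℕ.≤-trans (⌊n/2⌋-mono (n≤1+n (suc n))) ⌊n/2⌋<m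

eqHyp-halfSize : ∀ k {lam : Vect k} → InV lam → {P : Vect k → Set} → ∀ {j} → 1 ≤ j → j < k →
  Σ (Subset k) (λ U → Σ (Subset k) λ V → Σ (Subset k) λ W →
    (∣ U ∣ ≡ j × ∣ V ∣ ≡ j × ∣ W ∣ ≡ j) × SameInV P (EqHyp k lam U V W)) →
  Σ ℕ λ j′ → Σ (Subset k) λ U → Σ (Subset k) λ V → Σ (Subset k) λ W →
    (1 ≤ j′ × j′ ≤ ⌊ k /2⌋ × ∣ U ∣ ≡ j′ × ∣ V ∣ ≡ j′ × ∣ W ∣ ≡ j′) ×
    SameInV P (EqHyp k lam U V W)
eqHyp-halfSize k {lam} Σλ≡0 {j = j} 1≤j j<k (U , V , W , (∣U∣≡j , ∣V∣≡j , ∣W∣≡j) , P⇔eqHyp)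
  with j ≤? ⌊ k /2⌋
... | yes j≤⌊k/2⌋ = j , U , V , W , (1≤j , j≤⌊k/2⌋ , ∣U∣≡j , ∣V∣≡j , ∣W∣≡j) , P⇔eqHyp
... | no  j≰⌊k/2⌋ =
  k ∸ j , ∁ U , ∁ V , ∁ W ,
  (m<n⇒0<n∸m j<k , ⌊n/2⌋<m⇒n∸m≤⌊n/2⌋ k (ℕ.≰⇒> j≰⌊k/2⌋) ,
   ∣∁∣ U ∣U∣≡j , ∣∁∣ V ∣V∣≡j , ∣∁∣ W ∣W∣≡j) ,
  λ β Σβ≡0 → ⇔-trans (P⇔eqHyp β Σβ≡0) (eqHyp⇔eqHyp-∁ k Σλ≡0 U V W β Σβ≡0)
  where
  ∣∁∣ : ∀ S → ∣ S ∣ ≡ j → ∣ ∁ S ∣ ≡ k ∸ j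
  ∣∁∣ S ∣S∣≡j = trans (∣∁p∣≡n∸∣p∣ S) (cong (k ∸_) ∣S∣≡j)

proposition4p5 : (k : ℕ) → .{{_ : NonZero k}} → 2 ≤ k →
    (lam : Vect k) → IsDominant lam →
    ((ψ σ θ : Permutation′ k) (j : ℕ) → 1 ≤ j → j < k →
      Σ ℕ (λ j′ → Σ (Subset k) (λ U → Σ (Subset k) (λ V′ → Σ (Subset k) (λ W →
        (1 ≤ j′ × j′ ≤ ⌊ k /2⌋ × ∣ U ∣ ≡ j′ × ∣ V′ ∣ ≡ j′ × ∣ W ∣ ≡ j′) ×
        SameInV (KostantHyp k lam ψ σ θ j) (EqHyp k lam U V′ W))))))
    ×
    ((j : ℕ) (U V′ W : Subset k) →
      1 ≤ j → j ≤ ⌊ k /2⌋ → ∣ U ∣ ≡ j → ∣ V′ ∣ ≡ j → ∣ W ∣ ≡ j →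
      Σ (Permutation′ k) (λ ψ → Σ (Permutation′ k) (λ σ → Σ (Permutation′ k) (λ θ →
        Σ ℕ (λ j′ → (1 ≤ j′ × j′ < k) ×
          SameInV (KostantHyp k lam ψ σ θ j′) (EqHyp k lam U V′ W))))))
proposition4p5 k@(suc k-1) _ lam ((Σλ≡0 , _) , _) =
  (λ ψ σ θ j 1≤j j<k →
     eqHyp-halfSize k {lam} Σλ≡0 1≤j j<k (kostantHyp-isEqHyp k {lam} Σλ≡0 ψ σ θ j 1≤j (ℕ.<⇒≤ j<k))) ,
  (λ j U V W 1≤j j≤⌊k/2⌋ ∣U∣≡j ∣V∣≡j ∣W∣≡j →
     let ψ , σ , θ , same = eqHyp-isKostantHyp k {lam} Σλ≡0 U V W 1≤j ∣U∣≡j ∣V∣≡j ∣W∣≡j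
     in  ψ , σ , θ , j , (1≤j , ℕ.≤-<-trans j≤⌊k/2⌋ (⌊n/2⌋<n k-1)) , same)
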